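{- Let $n>1$ and let $G$ be a bipartite graph having two vertices $x$ and $y$ in the same partite set such that $N(x)$ is a proper subset of $N(y)$. If $H=G+K_1$, then $\chi_{ld}(H[\overline{K_n}])\ge 4$.
   Context: Standing assumption: all graphs considered admit a local distance antimagic labeling. For a graph $G=(V,E)$ of order $N$ and a bijection $f\colon V\to\{1,\dots,N\}$, the weight of a vertex $u$ is $w(u)=\sum_{x\in N(u)}f(x)$, where $N(u)$ is the open neighborhood of $u$. The bijection $f$ is a local distance antimagic labeling if $w(u)\neq w(v)$ for every edge $uv$. $\chi_{ld}(G)$ is the minimum number of distinct weights over all local distance antimagic labelings of $G$. $G+K_1$ is the join of $G$ with a single new vertex adjacent to all vertices of $G$. $\overline{K_n}$ is the edgeless graph on $n$ vertices. The lexicographic product $G[H]$ has vertex set $V(G)\times V(H)$, with $(g,h)$ adjacent to $(g',h')$ iff $gg'\in E(G)$, or $g=g'$ and $hh'\in E(H)$. -}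

module Defs where

open import Data.Nat using (ℕ; zero; suc; _+_; _*_)
import Data.Nat
open import Relation.Nullary using (yes; no)
import Data.Fin.Properties as FinP
open import Data.Bool using (_∨_; _∧_)
open import Relation.Nullary.Decidable using (⌊_⌋)
open import Data.Nat.Properties using (_≟_)
open import Data.Bool using (Bool; true; false; if_then_else_)
open import Data.Fin using (Fin; zero; suc; toℕ; remQuot)
open import Data.Product using (_×_; _,_; proj₁; proj₂; Σ; ∃)
open import Data.List using (List; map; length; deduplicate; allFin)
open import Data.Nat.ListAction using (sum)
open import Relation.Binary.PropositionalEquality using (_≡_; _≢_)
open import Function.Definitions using (Bijective)

record Graph (m : ℕ) : Set where
  field
    adj   : Fin m → Fin m → Bool
    sym   : ∀ u v → adj u v ≡ adj v u
    irrefl : ∀ u → adj u u ≡ false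
open Graph public

BipartiteWithSameSide : ∀ {m} → Graph m → Fin m → Fin m → Set
BipartiteWithSameSide G x y =
  Σ (Fin _ → Bool) λ c →
    (∀ u v → adj G u v ≡ true → c u ≢ c v) × (c x ≡ c y)

ProperNbhdSubset : ∀ {m} → Graph m → Fin m → Fin m → Set
ProperNbhdSubset G x y =
  (∀ z → adj G x z ≡ true → adj G y z ≡ true) ×
  (∃ λ z → adj G y z ≡ true × adj G x z ≡ false)

joinK1 : ∀ {m} → Graph m → Graph (suc m)
joinK1 {m} G = record { adj = a ; sym = s ; irrefl = r }
  where
  a : Fin (suc m) → Fin (suc m) → Bool
  a zero    zero    = false
  a zero    (suc j) = true
  a (suc i) zero    = true
  a (suc i) (suc j) = adj G i j
  s : ∀ u v → a u v ≡ a v u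
  s zero    zero    = _≡_.refl
  s zero    (suc j) = _≡_.refl
  s (suc i) zero    = _≡_.refl
  s (suc i) (suc j) = sym G i j
  r : ∀ u → a u u ≡ false
  r zero    = _≡_.refl
  r (suc i) = irrefl G i

emptyGraph : (n : ℕ) → Graph n
emptyGraph n = record { adj = λ _ _ → false ; sym = λ _ _ → _≡_.refl ; irrefl = λ _ → _≡_.refl }

-- Lexicographic product G[H], given by its adjacency on Fin (k * n),
-- identified with Fin k × Fin n via Data.Fin.remQuot:
-- (g,h) ~ (g',h')  iff  gg' ∈ E(G)  or  (g = g' and hh' ∈ E(H)).
lexAdjacency : ∀ {k n} → Graph k → Graph n → Fin (k * n) → Fin (k * n) → Bool
lexAdjacency {k} {n} G H u v with remQuot {k} n u | remQuot {k} n v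
... | (g , h) | (g' , h') = adj G g g' ∨ (⌊ g FinP.≟ g' ⌋ ∧ adj H h h')

-- Labels: a bijection f : V → Fin N, label of v is 1 + toℕ (f v) ∈ {1..N}.
label : ∀ {N} → (Fin N → Fin N) → Fin N → ℕ
label f v = suc (toℕ (f v))

weight : ∀ {N} → (Fin N → Fin N → Bool) → (Fin N → Fin N) → Fin N → ℕ
weight {N} A f u = sum (map (λ x → if A u x then label f x else 0) (allFin N))

IsLDALabeling : ∀ {N} → (Fin N → Fin N → Bool) → (Fin N → Fin N) → Set
IsLDALabeling A f = Bijective _≡_ _≡_ f × (∀ u v → A u v ≡ true → weight A f u ≢ weight A f v)

numWeights : ∀ {N} → (Fin N → Fin N → Bool) → (Fin N → Fin N) → ℕ
numWeights {N} A f = length (deduplicate _≟_ (map (weight A f) (allFin N)))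

-- χ_ld(G) ≥ c : every local distance antimagic labeling uses at least c weights
-- (χ_ld is the minimum over such labelings, which exist by the standing assumption).
χld≥ : ∀ {N} → (Fin N → Fin N → Bool) → ℕ → Set
χld≥ A c = ∀ f → IsLDALabeling A f → c Data.Nat.≤ numWeights A f

{-# OPTIONS --safe #-}
module Submission where

open import Defs
open import Data.Nat using (ℕ; suc; _≤_)
open import Data.Fin using (Fin)
open import Data.Bool using (Bool; true; false; _∨_; if_then_else_)
open import Data.Bool.Properties using (∧-zeroʳ; ∨-identityʳ; ¬-not)
import Data.Bool.Properties as Bool
open import Data.Empty using (⊥-elim)
open import Data.Fin using (zero; suc; combine; quotient)
open import Data.Fin.Properties using (remQuot-combine; injective⇒≤; any?)
open import Data.List using (List; []; _∷_; map; length; deduplicate; allFin; lookup)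
open import Data.List.Membership.Propositional using (_∈_)
open import Data.List.Membership.Propositional.Properties
  using (∈-map⁺; ∈-map⁻; ∈-allFin; ∈-deduplicate⁺; ∈-lookup)
open import Data.List.Membership.Setoid.Properties using (index-injective)
open import Data.List.Properties using (length-map)
open import Data.List.Relation.Binary.Subset.Propositional using (_⊆_)
open import Data.List.Relation.Unary.All using ([]; _∷_)
import Data.List.Relation.Unary.All as All
open import Data.List.Relation.Unary.AllPairs using ([]; _∷_)
open import Data.List.Relation.Unary.Any using (here; there)
open import Data.List.Relation.Unary.Unique.Propositional using (Unique)
open import Data.Nat using (_*_; _<_; z≤n; s≤s)
open import Data.Nat.ListAction using (sum)
open import Data.Nat.Properties using (_≟_; ≤-refl; +-mono-≤; +-mono-<-≤; +-mono-≤-<; <⇒≢)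
open import Data.Product using (∃; _×_; _,_; proj₁)
open import Function using (_∘_)
open import Relation.Binary.PropositionalEquality
  using (_≡_; _≢_; refl; trans; cong; subst; setoid)
import Relation.Binary.PropositionalEquality as ≡
open import Relation.Nullary using (yes; no)

-- In H[K̄ₙ] adjacency only depends on the H-coordinate, so the
-- copy of H formed by the vertices (g, 0) inherits properness of weights along
-- the edges of H, and since labels are positive, a vertex whose H-neighbourhood
-- is a proper subset of another's has strictly smaller weight.  The apex, x, y
-- and a neighbour z of y then get four distinct weights: the apex is adjacent to
-- all of them, w(x) < w(y), and z is adjacent to y and is chosen as a neighbour
-- of x if x has one (so z is adjacent to x) and as the witness of N(x) ⊊ N(y)
-- otherwise (then N(x) = {apex} ⊊ N(z) ∋ y, so w(x) < w(z)).

lookup-injective : ∀ {A : Set} {xs : List A} → Unique xs →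
                   ∀ i j → lookup xs i ≡ lookup xs j → i ≡ j
lookup-injective (_   ∷ _) zero    zero    _  = refl
lookup-injective (x∉ ∷ _) zero    (suc j) eq = ⊥-elim (All.lookup x∉ (∈-lookup j) eq)
lookup-injective (x∉ ∷ _) (suc i) zero    eq = ⊥-elim (All.lookup x∉ (∈-lookup i) (≡.sym eq))
lookup-injective (_   ∷ u) (suc i) (suc j) eq = cong suc (lookup-injective u i j eq)

unique-⊆⇒length≤ : ∀ {A : Set} {xs ys : List A} → Unique xs → xs ⊆ ys →
                   length xs ≤ length ys
unique-⊆⇒length≤ {A} u xs⊆ys = injective⇒≤ λ {i} {j} eq →
  lookup-injective u i j
    (index-injective (setoid A) (xs⊆ys (∈-lookup i)) (xs⊆ys (∈-lookup j)) eq)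

unique-weights⇒length≤numWeights :
  ∀ {N} (A : Fin N → Fin N → Bool) (f : Fin N → Fin N) (us : List (Fin N)) →
  Unique (map (weight A f) us) → length us ≤ numWeights A f
unique-weights⇒length≤numWeights {N} A f us distinct =
  subst (_≤ numWeights A f) (length-map (weight A f) us) (unique-⊆⇒length≤ distinct image⊆)
  where
  image⊆ : map (weight A f) us ⊆ deduplicate _≟_ (map (weight A f) (allFin N))
  image⊆ w∈ with u , _ , refl ← ∈-map⁻ (weight A f) w∈ =
    ∈-deduplicate⁺ _≟_ (∈-map⁺ (weight A f) (∈-allFin u))

sum-map-mono-≤ : ∀ {A : Set} (xs : List A) {g h : A → ℕ} → (∀ x → g x ≤ h x) →
                 sum (map g xs) ≤ sum (map h xs)
sum-map-mono-≤ []       g≤h = z≤n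
sum-map-mono-≤ (x ∷ xs) g≤h = +-mono-≤ (g≤h x) (sum-map-mono-≤ xs g≤h)

sum-map-mono-< : ∀ {A : Set} {xs : List A} {g h : A → ℕ} → (∀ x → g x ≤ h x) →
                 ∀ {x} → x ∈ xs → g x < h x → sum (map g xs) < sum (map h xs)
sum-map-mono-< {xs = _ ∷ xs} g≤h (here refl) gx<hx =
  +-mono-<-≤ gx<hx (sum-map-mono-≤ xs g≤h)
sum-map-mono-< {xs = y ∷ _}  g≤h (there x∈) gx<hx =
  +-mono-≤-< (g≤h y) (sum-map-mono-< g≤h x∈ gx<hx)

-- ProperNbhdSubset for a bare adjacency function: lexAdjacency is not a Graph.
ProperNbhdSubsetᴬ : ∀ {N} → (Fin N → Fin N → Bool) → Fin N → Fin N → Set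
ProperNbhdSubsetᴬ A u v =
  (∀ t → A u t ≡ true → A v t ≡ true) × (∃ λ t → A v t ≡ true × A u t ≡ false)

⊂⇒weight-< : ∀ {N} (A : Fin N → Fin N → Bool) (f : Fin N → Fin N) {u v : Fin N} →
             ProperNbhdSubsetᴬ A u v → weight A f u < weight A f v
⊂⇒weight-< {N} A f {u} {v} (u⊆v , t , vt , ut) =
  sum-map-mono-< term-mono (∈-allFin t) term-<
  where
  term : Fin N → Fin N → ℕ
  term s x = if A s x then label f x else 0
  term-mono : ∀ x → term u x ≤ term v x
  term-mono x with A u x in ux
  ... | false = z≤n
  ... | true rewrite u⊆v x ux = ≤-refl
  term-< : term u t < term v t
  term-< rewrite vt | ut = s≤s z≤n

quotient-combine : ∀ {k n} (g : Fin k) (h : Fin n) → quotient n (combine g h) ≡ g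
quotient-combine g h = cong proj₁ (remQuot-combine g h)

module _ {k n : ℕ} (G : Graph k) where

  lexAdjacency-emptyGraph : ∀ (u v : Fin (k * n)) →
    lexAdjacency G (emptyGraph n) u v ≡ adj G (quotient {k} n u) (quotient {k} n v)
  lexAdjacency-emptyGraph u v =
    trans (cong (adj G (quotient {k} n u) (quotient {k} n v) ∨_) (∧-zeroʳ _)) (∨-identityʳ _)

  lexAdjacency-emptyGraph-combine : ∀ (g : Fin k) (h : Fin n) v →
    lexAdjacency G (emptyGraph n) (combine g h) v ≡ adj G g (quotient {k} n v)
  lexAdjacency-emptyGraph-combine g h v =
    trans (lexAdjacency-emptyGraph (combine g h) v)
          (cong (λ g′ → adj G g′ (quotient {k} n v)) (quotient-combine g h))

  lexAdjacency-emptyGraph-combine₂ : ∀ (g g′ : Fin k) (h h′ : Fin n) →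
    lexAdjacency G (emptyGraph n) (combine g h) (combine g′ h′) ≡ adj G g g′
  lexAdjacency-emptyGraph-combine₂ g g′ h h′ =
    trans (lexAdjacency-emptyGraph-combine g h (combine g′ h′))
          (cong (adj G g) (quotient-combine g′ h′))

  lexAdjacency-emptyGraph-⊂ : ∀ (g g′ : Fin k) (h h′ : Fin n) → ProperNbhdSubset G g g′ →
    ProperNbhdSubsetᴬ (lexAdjacency G (emptyGraph n)) (combine g h) (combine g′ h′)
  lexAdjacency-emptyGraph-⊂ g g′ h h′ (g⊆g′ , t , g′t , gt) =
    lifted-⊆ , combine t h ,
    trans (lexAdjacency-emptyGraph-combine₂ g′ t h′ h) g′t ,
    trans (lexAdjacency-emptyGraph-combine₂ g t h h) gt
    where
    lifted-⊆ : ∀ v → lexAdjacency G (emptyGraph n) (combine g h) v ≡ true →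
                     lexAdjacency G (emptyGraph n) (combine g′ h′) v ≡ true
    lifted-⊆ v gv = trans (lexAdjacency-emptyGraph-combine g′ h′ v)
      (g⊆g′ _ (trans (≡.sym (lexAdjacency-emptyGraph-combine g h v)) gv))

module _ {m} {G : Graph m} where

  joinK1-⊂ : ∀ {a b} → ProperNbhdSubset G a b → ProperNbhdSubset (joinK1 G) (suc a) (suc b)
  joinK1-⊂ (a⊆b , t , bt , at) = (λ { zero _ → refl ; (suc j) → a⊆b j }) , suc t , bt , at

  joinK1-isolated-⊂ : ∀ {a b t} → (∀ j → adj G a j ≢ true) → adj G b t ≡ true →
                      ProperNbhdSubset (joinK1 G) (suc a) (suc b)
  joinK1-isolated-⊂ {t = t} isolated bt =
    (λ { zero _ → refl ; (suc j) aj → ⊥-elim (isolated j aj) }) ,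
    suc t , bt , ¬-not (isolated t)

module _ {m} (G : Graph m) (w : Fin (suc m) → ℕ)
         (adj⇒≢ : ∀ g g′ → adj (joinK1 G) g g′ ≡ true → w g ≢ w g′)
         (⊂⇒< : ∀ g g′ → ProperNbhdSubset (joinK1 G) g g′ → w g < w g′) where

  separatingNeighbour : ∀ {x y} → ProperNbhdSubset G x y →
                        ∃ λ z → adj G y z ≡ true × w (suc x) ≢ w (suc z)
  separatingNeighbour {x} {y} (x⊆y , z , yz , _) with any? (λ j → adj G x j Bool.≟ true)
  ... | yes (z′ , xz′) = z′ , x⊆y z′ xz′ , adj⇒≢ (suc x) (suc z′) xz′
  ... | no  isolated   =
    z , yz , <⇒≢ (⊂⇒< (suc x) (suc z) x⊂z)
    where
    x⊂z : ProperNbhdSubset (joinK1 G) (suc x) (suc z)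
    x⊂z = joinK1-isolated-⊂ (λ j → isolated ∘ (j ,_)) (trans (sym G z y) yz)

  fourDistinctWeights : ∀ {x y} → ProperNbhdSubset G x y →
                        ∃ λ z → Unique (map w (zero ∷ suc x ∷ suc y ∷ suc z ∷ []))
  fourDistinctWeights {x} {y} x⊂y with z , yz , wx≢wz ← separatingNeighbour x⊂y =
    z , (apex≢ x ∷ apex≢ y ∷ apex≢ z ∷ [])
      ∷ (<⇒≢ (⊂⇒< (suc x) (suc y) (joinK1-⊂ x⊂y)) ∷ wx≢wz ∷ [])
      ∷ (adj⇒≢ (suc y) (suc z) yz ∷ [])
      ∷ []
      ∷ []
    where
    apex≢ : ∀ g → w zero ≢ w (suc g)
    apex≢ g = adj⇒≢ zero (suc g) refl

mainTheorem20 : (m n : ℕ) → 2 ≤ n → (G : Graph m) → (x y : Fin m) →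
    BipartiteWithSameSide G x y → ProperNbhdSubset G x y →
    χld≥ (lexAdjacency (joinK1 G) (emptyGraph n)) 4
mainTheorem20 m (suc n) _ G x y _ x⊂y f (_ , lda) =
  let z , distinct = fourDistinctWeights G w adj⇒≢ ⊂⇒< x⊂y
  in  unique-weights⇒length≤numWeights A f
        (map layer₀ (zero ∷ suc x ∷ suc y ∷ suc z ∷ [])) distinct
  where
  A : Fin (suc m * suc n) → Fin (suc m * suc n) → Bool
  A = lexAdjacency (joinK1 G) (emptyGraph (suc n))
  layer₀ : Fin (suc m) → Fin (suc m * suc n)
  layer₀ g = combine g zero
  w : Fin (suc m) → ℕ
  w = weight A f ∘ layer₀
  adj⇒≢ : ∀ g g′ → adj (joinK1 G) g g′ ≡ true → w g ≢ w g′
  adj⇒≢ g g′ gg′ = lda (layer₀ g) (layer₀ g′)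
    (trans (lexAdjacency-emptyGraph-combine₂ (joinK1 G) g g′ zero zero) gg′)
  ⊂⇒< : ∀ g g′ → ProperNbhdSubset (joinK1 G) g g′ → w g < w g′
  ⊂⇒< g g′ g⊂g′ =
    ⊂⇒weight-< A f {layer₀ g} {layer₀ g′}
      (lexAdjacency-emptyGraph-⊂ (joinK1 G) g g′ zero zero g⊂g′)
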